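{- Let $k$ be a positive even integer and let $G$ be a graph with exactly $k$ edges, matching number $\beta(G)\ge k/2$, and a vertex of degree exactly $k/2$. Then: (a) $\beta(G) \le \frac k2 + 1$; (b) there is an edge $e\in E(G)$ such that $G-e$ can be decomposed into (i.e., its edge set is the edge-disjoint union of) a star $K_{1,k/2}$ and a graph isomorphic to $(\frac k2 - 1)K_2$; (c) every vertex $v$ of $G$ satisfies $\deg_G(v)\le 3$ or $\deg_G(v) = \frac k2$; (d) for every vertex $x$ of degree $\frac k2$ in $G$, there is a maximum matching of $G$ containing an edge incident with $x$.
   Context: The matching number $\beta(G)$ is the maximum number of pairwise non-incident edges of $G$. $(\frac k2-1)K_2$ denotes a matching with $\frac k2-1$ edges, and $K_{1,k/2}$ is a star with $k/2$ leaves. -}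

module Defs where

open import Data.Nat using (ℕ; _≤_)
open import Data.Fin using (Fin; _<_; _≟_)
open import Data.Product using (_×_; Σ; proj₁; proj₂; _,_)
open import Data.Sum using (_⊎_)
open import Data.List using (List; length; filter)
open import Data.List.Relation.Unary.All using (All)
open import Data.List.Relation.Unary.AllPairs using (AllPairs)
open import Data.List.Relation.Unary.Unique.Propositional using (Unique)
open import Data.List.Membership.Propositional using (_∈_)
open import Relation.Binary.PropositionalEquality using (_≡_)
open import Relation.Nullary using (¬_; Dec)
open import Relation.Nullary.Decidable using (_⊎-dec_)

-- An edge on vertex set Fin n is stored as an ordered pair (u , v) with u < v,
-- so each unordered pair {u,v} has exactly one representation.
Edge : ℕ → Set
Edge n = Fin n × Fin n

record Graph : Set where
  field
    n       : ℕ
    edges   : List (Edge n)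
    ordered : All (λ e → proj₁ e < proj₂ e) edges
    unique  : Unique edges
open Graph public

Incident : {n : ℕ} → Fin n → Edge n → Set
Incident v e = v ≡ proj₁ e ⊎ v ≡ proj₂ e

incident? : {n : ℕ} → (v : Fin n) → (e : Edge n) → Dec (Incident v e)
incident? v e = (v ≟ proj₁ e) ⊎-dec (v ≟ proj₂ e)

size : Graph → ℕ
size G = length (edges G)

deg : (G : Graph) → Fin (n G) → ℕ
deg G v = length (filter (incident? v) (edges G))

Disjoint : {n : ℕ} → Edge n → Edge n → Set
Disjoint e f = ¬ (Σ _ λ v → Incident v e × Incident v f)

-- M is a matching of G: a list of edges of G, pairwise non-incident
-- (pairwise disjointness also forces the edges of M to be distinct)
IsMatching : (G : Graph) → List (Edge (n G)) → Set
IsMatching G M = All (_∈ edges G) M × AllPairs Disjoint M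

IsMaximumMatching : (G : Graph) → List (Edge (n G)) → Set
IsMaximumMatching G M = IsMatching G M × (∀ M′ → IsMatching G M′ → length M′ ≤ length M)

MatchingNumber≥ : Graph → ℕ → Set
MatchingNumber≥ G t = Σ (List (Edge (n G))) λ M → IsMatching G M × t ≤ length M

MatchingNumber≤ : Graph → ℕ → Set
MatchingNumber≤ G t = ∀ M → IsMatching G M → length M ≤ t

{-# OPTIONS --safe #-}
-- Fix a vertex x of degree m = k/2. The m edges avoiding x contain all but at
-- most one edge of any matching, and a matching has at most one edge at x;
-- this gives β(G) ≤ m + 1, and, for a matching of size m, shows that the edges
-- avoiding x are a matching plus one edge e. Every other vertex therefore
-- meets at most one edge at x (G is simple), at most e, and at most one
-- matching edge. For (d), a maximum matching can be exhibited because a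
-- matching of size m + 1 must consist of an edge at x together with all the
-- edges avoiding x, which is a checkable condition; and an edge s at x can
-- always be exchanged into a maximum matching: added if disjoint from it, and
-- otherwise swapped for the matching edge meeting the other endpoint of s.
module Submission where

open import Defs
open import Data.Nat using (ℕ; _≤_; _<_; _+_; _*_; _∸_; suc; z≤n; s≤s; s≤s⁻¹)
open import Data.Nat.Properties
  using (≤-refl; ≤-trans; ≤-reflexive; ≮⇒≥; n≤1+n; ≤⇒≯; m≤m+n; m<m+n; +-comm; +-mono-≤; +-monoˡ-≤;
         +-cancelˡ-≡; +-cancelˡ-≤; +-identityʳ; module ≤-Reasoning)
open import Data.Fin as Fin using (Fin)
open import Data.Fin.Properties using (<-asym) renaming (any? to ∃-Fin?)
open import Data.Product using (_×_; Σ; ∃; ∃₂; _,_; proj₁; proj₂)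
open import Data.Sum using (_⊎_; inj₁; inj₂)
open import Data.List using (List; length; _∷_; _++_; []; [_]; filter)
open import Data.List.Properties using (length-++; filter-++; partition-defn; ++-identityʳ)
open import Data.List.Relation.Unary.All as All using (All; []; _∷_; all?)
open import Data.List.Relation.Unary.All.Properties
  using (all-filter; ¬Any⇒All¬; ¬All⇒Any¬) renaming (filter⁺ to All-filter⁺)
open import Data.List.Relation.Unary.Any using (Any; here; there; any?)
open import Data.List.Relation.Unary.AllPairs as AllPairs using (AllPairs; []; _∷_; allPairs?)
open import Data.List.Relation.Unary.AllPairs.Properties using () renaming (filter⁺ to AllPairs-filter⁺)
open import Data.List.Relation.Unary.Unique.Propositional using (Unique)
open import Data.List.Membership.Propositional using (_∈_; find; lose)
open import Data.List.Membership.Propositional.Properties using (∈-∃++; ∈-filter⁺; ∈-filter⁻)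
open import Data.List.Relation.Binary.Subset.Propositional.Properties using (filter-⊆)
open import Data.List.Relation.Binary.Permutation.Propositional
  using (_↭_; ↭-refl; prep; ↭-sym; ↭-trans; ↭ₛ⇒↭; ↭⇒↭ₛ)
open import Data.List.Relation.Binary.Permutation.Propositional.Properties
  using (shift; ∷↭∷ʳ; ∈-resp-↭; All-resp-↭; ↭-length; ++⁺ˡ; filter-↭)
import Data.List.Relation.Binary.Permutation.Setoid.Properties as Setoid↭
open import Relation.Binary.PropositionalEquality
  using (_≡_; _≢_; refl; sym; trans; cong; subst; setoid; resp₂; module ≡-Reasoning)
open import Relation.Binary.Definitions using (Symmetric)
open import Relation.Nullary using (¬_; Dec; yes; no)
open import Relation.Nullary.Decidable using (¬?; _×-dec_)
open import Relation.Unary using (Pred; Decidable)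
open import Relation.Unary.Properties using (∁?)
open import Data.Empty using (⊥-elim)
open import Level using (0ℓ)
open import Function using (_∘_; case_of_)

module _ {A : Set} where

  filter-∁-↭ : {P : Pred A 0ℓ} (P? : Decidable P) (xs : List A) →
               xs ↭ filter P? xs ++ filter (∁? P?) xs
  filter-∁-↭ P? xs = subst (λ p → xs ↭ proj₁ p ++ proj₂ p) (partition-defn P? xs)
                           (↭ₛ⇒↭ (Setoid↭.partition-↭ (setoid A) P? xs))

  length-↭-++ : (xs : List A) {ys zs : List A} → ys ↭ xs ++ zs → length xs + length zs ≡ length ys
  length-↭-++ xs ys↭xs++zs = sym (trans (↭-length ys↭xs++zs) (length-++ xs))

  length-filter-∁ : {P : Pred A 0ℓ} (P? : Decidable P) (xs : List A) →
                    length (filter P? xs) + length (filter (∁? P?) xs) ≡ length xs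
  length-filter-∁ P? xs = length-↭-++ (filter P? xs) (filter-∁-↭ P? xs)

  length-filter-∷ : {P : Pred A 0ℓ} (P? : Decidable P) (a : A) (xs : List A) →
                    length (filter P? (a ∷ xs)) ≤ suc (length (filter P? xs))
  length-filter-∷ P? a xs with P? a
  ... | yes _ = ≤-refl
  ... | no _  = n≤1+n _

  AllPairs-resp-↭ : {R : A → A → Set} → Symmetric R →
                    {xs ys : List A} → xs ↭ ys → AllPairs R xs → AllPairs R ys
  AllPairs-resp-↭ {R} R-sym xs↭ys =
    Setoid↭.AllPairs-resp-↭ (setoid A) R-sym (resp₂ R) (↭⇒↭ₛ xs↭ys)

  ∈⇒↭∷ : {x : A} {ys : List A} → x ∈ ys → ∃ λ zs → ys ↭ x ∷ zs
  ∈⇒↭∷ {x} x∈ys with ∈-∃++ x∈ys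
  ... | us , vs , refl = us ++ vs , shift x us vs

  ∈-↭∷-≢ : {x y : A} {ys ys′ : List A} → ys ↭ x ∷ ys′ → x ≢ y → y ∈ ys → y ∈ ys′
  ∈-↭∷-≢ ys↭x∷ys′ x≢y y∈ys with ∈-resp-↭ ys↭x∷ys′ y∈ys
  ... | here y≡x    = ⊥-elim (x≢y (sym y≡x))
  ... | there y∈ys′ = y∈ys′

  unique-⊆⇒↭++ : {xs ys : List A} → Unique xs → All (_∈ ys) xs → ∃ λ zs → ys ↭ xs ++ zs
  unique-⊆⇒↭++ {[]}     {ys} _ _ = ys , ↭-refl
  unique-⊆⇒↭++ {x ∷ xs} (x∉xs ∷ xs-unique) (x∈ys ∷ xs⊆ys)
    with ys′ , ys↭x∷ys′ ← ∈⇒↭∷ x∈ys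
    with zs , ys′↭xs++zs ← unique-⊆⇒↭++ xs-unique
           (All.zipWith (λ (x≢y , y∈ys) → ∈-↭∷-≢ ys↭x∷ys′ x≢y y∈ys) (x∉xs , xs⊆ys))
    = zs , ↭-trans ys↭x∷ys′ (prep x ys′↭xs++zs)

  length≤1-if-pairwise-incompatible :
    {R : A → A → Set} {Q : A → Set} → (∀ {a b} → Q a → Q b → ¬ R a b) →
    {xs : List A} → AllPairs R xs → All Q xs → length xs ≤ 1
  length≤1-if-pairwise-incompatible _ []                    []           = z≤n
  length≤1-if-pairwise-incompatible _ (_ ∷ [])              (_ ∷ [])     = s≤s z≤n
  length≤1-if-pairwise-incompatible f ((Rab ∷ _) ∷ _) (Qa ∷ Qb ∷ _) = ⊥-elim (f Qa Qb Rab)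

  pairwise-++-≤1⇒↭∷ : {R : A → A → Set} {ys xs zs : List A} → ys ↭ xs ++ zs →
                      AllPairs R xs → length zs ≤ 1 → 0 < length ys →
                      ∃₂ λ e Q → ys ↭ e ∷ Q × AllPairs R Q
  pairwise-++-≤1⇒↭∷ {xs = []}    {[]}    ys↭[] _ _ 0<|ys|
    with () ← subst (0 <_) (↭-length ys↭[]) 0<|ys|
  pairwise-++-≤1⇒↭∷ {ys = ys} {xs = e ∷ Q} {[]} ys↭xs (_ ∷ Q-pairwise) _ _ =
    e , Q , subst (ys ↭_) (++-identityʳ (e ∷ Q)) ys↭xs , Q-pairwise
  pairwise-++-≤1⇒↭∷ {xs = xs} {e ∷ []} ys↭xs∷ʳe xs-pairwise _ _ =
    e , xs , ↭-trans ys↭xs∷ʳe (↭-sym (∷↭∷ʳ e xs)) , xs-pairwise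
  pairwise-++-≤1⇒↭∷ {zs = _ ∷ _ ∷ _} _ _ (s≤s ()) _

  nonempty⇒∈ : {xs : List A} → 0 < length xs → ∃ λ a → a ∈ xs
  nonempty⇒∈ {a ∷ _} _ = a , here refl

  singleton-and-empty-if-over-count :
    {N : ℕ} (I P R : List A) → length I ≤ 1 → length P + length R ≡ N →
    N < length I + length P → ∃ λ s → I ≡ [ s ] × R ≡ []
  singleton-and-empty-if-over-count [] P R _ |P++R|≡N N<|P| =
    ⊥-elim (≤⇒≯ (subst (length P ≤_) |P++R|≡N (m≤m+n (length P) (length R))) N<|P|)
  singleton-and-empty-if-over-count (s ∷ []) P [] _ _ _ = s , refl , refl
  singleton-and-empty-if-over-count (s ∷ []) P (_ ∷ R) _ |P++R|≡N N<1+|P| =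
    ⊥-elim (≤⇒≯ (s≤s⁻¹ N<1+|P|) (subst (length P <_) |P++R|≡N (m<m+n (length P) (s≤s z≤n))))
  singleton-and-empty-if-over-count (_ ∷ _ ∷ _) _ _ (s≤s ()) _ _

module _ {n : ℕ} where

  disjoint? : (e f : Edge n) → Dec (Disjoint e f)
  disjoint? e f = ¬? (∃-Fin? λ v → incident? v e ×-dec incident? v f)

  Disjoint-sym : Symmetric (Disjoint {n})
  Disjoint-sym e#f (v , v∈f , v∈e) = e#f (v , v∈e , v∈f)

  Disjoint⇒≢ : {e f : Edge n} → Disjoint e f → e ≢ f
  Disjoint⇒≢ {e} e#e refl = e#e (proj₁ e , inj₁ refl , inj₁ refl)

  OrderedEdgeThrough : Fin n → Fin n → Edge n → Set
  OrderedEdgeThrough v x a = Incident v a × Incident x a × proj₁ a Fin.< proj₂ a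

  ordered-edge-through-unique : {v x : Fin n} {a b : Edge n} → v ≢ x →
    OrderedEdgeThrough v x a → OrderedEdgeThrough v x b → a ≡ b
  ordered-edge-through-unique v≢x (inj₁ refl , inj₁ refl , _) _ = ⊥-elim (v≢x refl)
  ordered-edge-through-unique v≢x (inj₂ refl , inj₂ refl , _) _ = ⊥-elim (v≢x refl)
  ordered-edge-through-unique v≢x _ (inj₁ refl , inj₁ refl , _) = ⊥-elim (v≢x refl)
  ordered-edge-through-unique v≢x _ (inj₂ refl , inj₂ refl , _) = ⊥-elim (v≢x refl)
  ordered-edge-through-unique _ (inj₁ refl , inj₂ refl , _) (inj₁ refl , inj₂ refl , _) = refl
  ordered-edge-through-unique _ (inj₂ refl , inj₁ refl , _) (inj₂ refl , inj₁ refl , _) = refl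
  ordered-edge-through-unique _ (inj₁ refl , inj₂ refl , a₁<a₂) (inj₂ refl , inj₁ refl , b₁<b₂) =
    ⊥-elim (<-asym a₁<a₂ b₁<b₂)
  ordered-edge-through-unique _ (inj₂ refl , inj₁ refl , a₁<a₂) (inj₁ refl , inj₂ refl , b₁<b₂) =
    ⊥-elim (<-asym a₁<a₂ b₁<b₂)

  other-endpoint-unique : {x v w : Fin n} {s : Edge n} →
    Incident x s → Incident v s → Incident w s → v ≢ x → w ≢ x → v ≡ w
  other-endpoint-unique (inj₁ refl) (inj₁ refl) _           v≢x _   = ⊥-elim (v≢x refl)
  other-endpoint-unique (inj₁ refl) (inj₂ _)    (inj₁ refl) _   w≢x = ⊥-elim (w≢x refl)
  other-endpoint-unique (inj₁ _)    (inj₂ refl) (inj₂ refl) _   _   = refl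
  other-endpoint-unique (inj₂ refl) (inj₂ refl) _           v≢x _   = ⊥-elim (v≢x refl)
  other-endpoint-unique (inj₂ refl) (inj₁ _)    (inj₂ refl) _   w≢x = ⊥-elim (w≢x refl)
  other-endpoint-unique (inj₂ _)    (inj₁ refl) (inj₁ refl) _   _   = refl

  -- s and f share the endpoint of s other than x, which g avoids.
  Disjoint-exchange : {x : Fin n} {s f g : Edge n} → Incident x s → ¬ Disjoint s f →
    Disjoint f g → ¬ Incident x f → ¬ Incident x g → Disjoint s g
  Disjoint-exchange {x} {s} {f} {g} x∈s s∦f f#g x∉f x∉g (w , w∈s , w∈g) =
    s∦f λ (v , v∈s , v∈f) →
      f#g (w , subst (λ u → Incident u f) (v≡w v∈s v∈f) v∈f , w∈g)
    where
      v≡w : ∀ {v} → Incident v s → Incident v f → v ≡ w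
      v≡w {v} v∈s v∈f = other-endpoint-unique x∈s v∈s w∈s
        (λ v≡x → x∉f (subst (λ u → Incident u f) v≡x v∈f))
        (λ w≡x → x∉g (subst (λ u → Incident u g) w≡x w∈g))

module _ (G : Graph) where

  private
    V = Fin (n G)
    E = Edge (n G)

  incidentTo : V → List E → List E
  incidentTo x = filter (incident? x)

  avoiding : V → List E → List E
  avoiding x = filter (∁? (incident? x))

  deg+avoiding≡size : (x : V) → deg G x + length (avoiding x (edges G)) ≡ size G
  deg+avoiding≡size x = length-filter-∁ (incident? x) (edges G)

  deg-resp-↭ : {L : List E} (v : V) → edges G ↭ L → deg G v ≡ length (incidentTo v L)
  deg-resp-↭ v E↭L = ↭-length (filter-↭ (incident? v) E↭L)

  pairwiseDisjoint⇒incidentTo-length≤1 : {L : List E} (x : V) →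
    AllPairs Disjoint L → length (incidentTo x L) ≤ 1
  pairwiseDisjoint⇒incidentTo-length≤1 {L} x L-pairwise =
    length≤1-if-pairwise-incompatible (λ x∈a x∈b a#b → a#b (x , x∈a , x∈b))
      (AllPairs-filter⁺ (incident? x) L-pairwise) (all-filter (incident? x) L)

  -- This is where simplicity of G enters: the list of edges is duplicate-free
  -- and each edge is stored in one orientation.
  incidentTo-incidentTo-length≤1 : {v x : V} → v ≢ x →
    length (incidentTo v (incidentTo x (edges G))) ≤ 1
  incidentTo-incidentTo-length≤1 {v} {x} v≢x =
    length≤1-if-pairwise-incompatible
      {Q = OrderedEdgeThrough v x}
      (λ a b a≢b → a≢b (ordered-edge-through-unique v≢x a b))
      (AllPairs-filter⁺ (incident? v) (AllPairs-filter⁺ (incident? x) (unique G)))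
      (All.zip (all-filter (incident? v) (incidentTo x (edges G)) ,
                All-filter⁺ (incident? v) (All.zip (all-filter (incident? x) (edges G) ,
                                                    All-filter⁺ (incident? x) (ordered G)))))

  matching-avoiding-↭ : {L : List E} (x : V) → IsMatching G L →
    ∃ λ R → avoiding x (edges G) ↭ avoiding x L ++ R
  matching-avoiding-↭ {L} x (L⊆E , L-pairwise) =
    unique-⊆⇒↭++ (AllPairs-filter⁺ (∁? (incident? x)) (AllPairs.map Disjoint⇒≢ L-pairwise))
                 (All.tabulate λ e∈ →
                   let e∈L , x∉e = ∈-filter⁻ (∁? (incident? x)) e∈
                   in ∈-filter⁺ (∁? (incident? x)) (All.lookup L⊆E e∈L) x∉e)

  matching-length≤suc-avoiding : {L : List E} (x : V) → IsMatching G L →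
    length L ≤ suc (length (avoiding x (edges G)))
  matching-length≤suc-avoiding {L} x L-matching@(_ , L-pairwise)
    with R , N↭ ← matching-avoiding-↭ x L-matching = begin
      length L                                             ≡⟨ sym (length-filter-∁ (incident? x) L) ⟩
      length (incidentTo x L) + length (avoiding x L)
        ≤⟨ +-mono-≤ (pairwiseDisjoint⇒incidentTo-length≤1 x L-pairwise) (m≤m+n _ (length R)) ⟩
      suc (length (avoiding x L) + length R)               ≡⟨ cong suc (length-↭-++ (avoiding x L) N↭) ⟩
      suc (length (avoiding x (edges G)))                  ∎
    where open ≤-Reasoning

  avoiding-↭-edge∷matching : {M : List E} (x : V) → IsMatching G M →
    length (avoiding x (edges G)) ≤ length M → 0 < length (avoiding x (edges G)) →
    ∃₂ λ e Q → avoiding x (edges G) ↭ e ∷ Q × AllPairs Disjoint Q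
  avoiding-↭-edge∷matching {M} x M-matching@(_ , M-pairwise) N≤|M| 0<N
    with R , N↭ ← matching-avoiding-↭ x M-matching =
    pairwise-++-≤1⇒↭∷ N↭ (AllPairs-filter⁺ (∁? (incident? x)) M-pairwise) |R|≤1 0<N
    where
      open ≤-Reasoning
      P = avoiding x M
      |R|≤1 : length R ≤ 1
      |R|≤1 = +-cancelˡ-≤ (length P) _ _ (begin
        length P + length R                       ≡⟨ length-↭-++ P N↭ ⟩
        length (avoiding x (edges G))             ≤⟨ N≤|M| ⟩
        length M                                  ≡⟨ sym (length-filter-∁ (incident? x) M) ⟩
        length (incidentTo x M) + length P
          ≤⟨ +-monoˡ-≤ _ (pairwiseDisjoint⇒incidentTo-length≤1 x M-pairwise) ⟩
        1 + length P                              ≡⟨ +-comm 1 _ ⟩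
        length P + 1                              ∎)

  avoiding-length≡half : {m : ℕ} (x : V) → size G ≡ 2 * m → deg G x ≡ m →
    length (avoiding x (edges G)) ≡ m
  avoiding-length≡half {m} x size≡2m deg≡m =
    trans (+-cancelˡ-≡ m _ _ (begin
      m + length (avoiding x (edges G))       ≡⟨ cong (_+ _) (sym deg≡m) ⟩
      deg G x + length (avoiding x (edges G)) ≡⟨ deg+avoiding≡size x ⟩
      size G                                  ≡⟨ size≡2m ⟩
      m + (m + 0)                             ∎)) (+-identityʳ m)
    where open ≡-Reasoning

  edges-↭-edge∷star++matching : {m : ℕ} {M₀ : List E} (x : V) →
    size G ≡ 2 * m → deg G x ≡ m → 0 < m → IsMatching G M₀ → m ≤ length M₀ →
    ∃₂ λ e Q → edges G ↭ e ∷ (incidentTo x (edges G) ++ Q) × AllPairs Disjoint Q × length Q ≡ m ∸ 1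
  edges-↭-edge∷star++matching {m} x size≡2m deg≡m 0<m M₀-matching m≤|M₀| =
    assemble (avoiding-↭-edge∷matching x M₀-matching (subst (_≤ _) (sym N≡m) m≤|M₀|)
                                                       (subst (0 <_) (sym N≡m) 0<m))
    where
      S = incidentTo x (edges G)
      N = avoiding x (edges G)
      N≡m = avoiding-length≡half x size≡2m deg≡m
      assemble : (∃₂ λ e Q → N ↭ e ∷ Q × AllPairs Disjoint Q) →
                 ∃₂ λ e Q → edges G ↭ e ∷ (S ++ Q) × AllPairs Disjoint Q × length Q ≡ m ∸ 1
      assemble (e , Q , N↭e∷Q , Q-pairwise) =
        e , Q , ↭-trans (filter-∁-↭ (incident? x) (edges G)) (↭-trans (++⁺ˡ S N↭e∷Q) (shift e S Q)) ,
        Q-pairwise , cong (_∸ 1) (trans (sym (↭-length N↭e∷Q)) N≡m)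

  deg≤3-off-centre : {x v : V} {e : E} {Q : List E} → v ≢ x →
    edges G ↭ e ∷ (incidentTo x (edges G) ++ Q) → AllPairs Disjoint Q → deg G v ≤ 3
  deg≤3-off-centre {x} {v} {e} {Q} v≢x E↭ Q-pairwise = begin
    deg G v                                          ≡⟨ deg-resp-↭ v E↭ ⟩
    length (incidentTo v (e ∷ (S ++ Q)))             ≤⟨ length-filter-∷ (incident? v) e (S ++ Q) ⟩
    suc (length (incidentTo v (S ++ Q)))             ≡⟨ cong (suc ∘ length) (filter-++ (incident? v) S Q) ⟩
    suc (length (incidentTo v S ++ incidentTo v Q))  ≡⟨ cong suc (length-++ (incidentTo v S)) ⟩
    suc (length (incidentTo v S) + length (incidentTo v Q))
      ≤⟨ s≤s (+-mono-≤ (incidentTo-incidentTo-length≤1 v≢x) (pairwiseDisjoint⇒incidentTo-length≤1 v Q-pairwise)) ⟩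
    3                                                ∎
    where
      open ≤-Reasoning
      S = incidentTo x (edges G)

  large-matching⇒extensible-avoiding : {L : List E} (x : V) → IsMatching G L →
    length (avoiding x (edges G)) < length L →
    Any (λ s → AllPairs Disjoint (s ∷ avoiding x (edges G))) (incidentTo x (edges G))
  large-matching⇒extensible-avoiding {L} x L-matching@(L⊆E , L-pairwise) N<|L|
    with R , N↭ ← matching-avoiding-↭ x L-matching
    with s , I≡[s] , refl ← singleton-and-empty-if-over-count (incidentTo x L) (avoiding x L) R
           (pairwiseDisjoint⇒incidentTo-length≤1 x L-pairwise) (length-↭-++ (avoiding x L) N↭)
           (subst (_ <_) (sym (length-filter-∁ (incident? x) L)) N<|L|)
    = lose s∈S s∷N-pairwise
    where
      L↭s∷P : L ↭ s ∷ avoiding x L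
      L↭s∷P = subst (λ I → L ↭ I ++ avoiding x L) I≡[s] (filter-∁-↭ (incident? x) L)
      P↭N : avoiding x L ↭ avoiding x (edges G)
      P↭N = ↭-sym (subst (avoiding x (edges G) ↭_) (++-identityʳ _) N↭)
      s∷N-pairwise : AllPairs Disjoint (s ∷ avoiding x (edges G))
      s∷N-pairwise = AllPairs-resp-↭ Disjoint-sym (prep s P↭N)
                       (AllPairs-resp-↭ Disjoint-sym L↭s∷P L-pairwise)
      s∈S : s ∈ incidentTo x (edges G)
      s∈S with s∈L , x∈s ← ∈-filter⁻ (incident? x) (subst (s ∈_) (sym I≡[s]) (here refl))
        = ∈-filter⁺ (incident? x) (All.lookup L⊆E s∈L) x∈s

  -- Either some matching has size |avoiding x| + 1, and then it is maximum, or
  -- the given matching already is.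
  maximumMatching-exists : {M₀ : List E} (x : V) → IsMatching G M₀ →
    length (avoiding x (edges G)) ≤ length M₀ → ∃ (IsMaximumMatching G)
  maximumMatching-exists {M₀} x M₀-matching N≤|M₀|
    with any? (λ s → allPairs? disjoint? (s ∷ avoiding x (edges G))) (incidentTo x (edges G))
  ... | yes extensible with s , s∈S , s∷N-pairwise ← find extensible =
    s ∷ avoiding x (edges G) ,
    (proj₁ (∈-filter⁻ (incident? x) s∈S) ∷ All.tabulate (filter-⊆ (∁? (incident? x)) (edges G)) ,
     s∷N-pairwise) ,
    λ L L-matching → matching-length≤suc-avoiding x L-matching
  ... | no ¬extensible =
    M₀ , M₀-matching ,
    λ L L-matching →
      ≤-trans (≮⇒≥ (¬extensible ∘ large-matching⇒extensible-avoiding x L-matching)) N≤|M₀|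

  exchange-into-matching : {M : List E} {x : V} {s : E} → IsMatching G M →
    s ∈ edges G → Incident x s →
    ∃ λ M′ → IsMatching G M′ × length M ≤ length M′ × Any (Incident x) M′
  exchange-into-matching {M} {x} {s} M-matching@(M⊆E , M-pairwise) s∈E x∈s
    with any? (incident? x) M
  ... | yes M-meets-x = M , M-matching , ≤-refl , M-meets-x
  ... | no M-avoids-x with all? (disjoint? s) M
  ...   | yes s#M = s ∷ M , (s∈E ∷ M⊆E , s#M ∷ M-pairwise) , n≤1+n _ , here x∈s
  ...   | no ¬s#M
    with f , f∈M , s∦f ← find (¬All⇒Any¬ (disjoint? s) M ¬s#M)
    with M′ , M↭f∷M′ ← ∈⇒↭∷ f∈M
    with f#M′ ∷ M′-pairwise ← AllPairs-resp-↭ Disjoint-sym M↭f∷M′ M-pairwise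
    with x∉f ∷ x∉M′ ← All-resp-↭ M↭f∷M′ (¬Any⇒All¬ M M-avoids-x)
    with _ ∷ M′⊆E ← All-resp-↭ M↭f∷M′ M⊆E
    = s ∷ M′ ,
      (s∈E ∷ M′⊆E ,
       All.zipWith (λ (f#g , x∉g) → Disjoint-exchange x∈s s∦f f#g x∉f x∉g) (f#M′ , x∉M′)
         ∷ M′-pairwise) ,
      ≤-reflexive (↭-length M↭f∷M′) , here x∈s

  maximumMatching-through : {M₀ : List E} (x : V) → 0 < deg G x → IsMatching G M₀ →
    length (avoiding x (edges G)) ≤ length M₀ →
    Σ (List E) λ M → IsMaximumMatching G M × Any (Incident x) M
  maximumMatching-through x 0<deg M₀-matching N≤|M₀|
    with M , M-matching , M-maximum ← maximumMatching-exists x M₀-matching N≤|M₀|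
    with s , s∈S ← nonempty⇒∈ 0<deg
    with s∈E , x∈s ← ∈-filter⁻ (incident? x) s∈S
    with M′ , M′-matching , |M|≤|M′| , M′-meets-x ← exchange-into-matching M-matching s∈E x∈s
    = M′ , (M′-matching , λ L L-matching → ≤-trans (M-maximum L L-matching) |M|≤|M′|) , M′-meets-x

positive-half : {m : ℕ} → 0 < 2 * m → 0 < m
positive-half {suc _} _ = s≤s z≤n

lemma3p4 : (k m : ℕ) → 0 < k → k ≡ 2 * m → (G : Graph) →
    size G ≡ k → MatchingNumber≥ G m → Σ (Fin (n G)) (λ v → deg G v ≡ m) →
    MatchingNumber≤ G (m + 1)
    × (Σ (Edge (n G)) λ e → e ∈ edges G × Σ (Fin (n G)) λ c →
         Σ (List (Edge (n G))) λ S → Σ (List (Edge (n G))) λ M →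
           (edges G ↭ (e ∷ (S ++ M)))
           × (length S ≡ m × All (Incident c) S)
           × (length M ≡ m ∸ 1 × AllPairs Disjoint M))
    × (∀ v → deg G v ≤ 3 ⊎ deg G v ≡ m)
    × (∀ x → deg G x ≡ m →
         Σ (List (Edge (n G))) λ M → IsMaximumMatching G M × Any (Incident x) M)
lemma3p4 .(2 * m) m 0<2m refl G size≡2m (M₀ , M₀-matching , m≤|M₀|) (c , deg-c≡m)
  with e , Q , E↭ , Q-pairwise , |Q|≡m∸1 ←
         edges-↭-edge∷star++matching G c size≡2m deg-c≡m (positive-half 0<2m) M₀-matching m≤|M₀|
  = (λ L L-matching → subst (length L ≤_) (trans (cong suc (N≡m c deg-c≡m)) (+-comm 1 m))
                              (matching-length≤suc-avoiding G c L-matching))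
  , (e , ∈-resp-↭ (↭-sym E↭) (here refl) , c , incidentTo G c (edges G) , Q , E↭ ,
     (deg-c≡m , all-filter (incident? c) (edges G)) , (|Q|≡m∸1 , Q-pairwise))
  , (λ v → case v Fin.≟ c of λ where
       (yes refl) → inj₂ deg-c≡m
       (no v≢c)   → inj₁ (deg≤3-off-centre G v≢c E↭ Q-pairwise))
  , λ x deg-x≡m → maximumMatching-through G x (subst (0 <_) (sym deg-x≡m) (positive-half 0<2m)) M₀-matching
                    (subst (_≤ length M₀) (sym (N≡m x deg-x≡m)) m≤|M₀|)
  where
    N≡m : ∀ x → deg G x ≡ m → length (avoiding G x (edges G)) ≡ m
    N≡m x = avoiding-length≡half G x size≡2m
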